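{- Let $2\le r\le d$ and $n\ge3$ be integers. Let $K(r)=\{(j_1,\dots,j_{d-r+1}):1\le j_1<\dots<j_{d-r+1}\le d\}$, for $k\in K(r)$ let $T(k)=\{x\in[n]^d: x_j=1 \text{ for all } j\in\{k_1,\dots,k_{d-r+1}\}\}$, and let $D(r)=\bigcup_{k\in K(r)}T(k)$. Let $\omega$ be the configuration on $\mathbb{T}_n^d$ whose active vertices are precisely those in $D(r)$. Then $\omega$ is a monotone dynamo under reversible $r$-bootstrap percolation, and consequently a dynamo under $r$-bootstrap percolation.
   Context: The $d$-dimensional torus $\mathbb{T}_n^d$ is the graph with vertex set $[n]^d=\{1,\dots,n\}^d$, where two vertices are adjacent iff they differ in exactly one coordinate $j$ and in that coordinate $x_j-x'_j\equiv\pm1\pmod n$. A configuration assigns each vertex a state active (1) or inactive (0). In $r$-bootstrap percolation, in each round an inactive vertex with at least $r$ active neighbors becomes active and active vertices stay active forever. In reversible $r$-bootstrap percolation, in each round every vertex becomes active if it has at least $r$ active neighbors and inactive otherwise. A dynamo is an initial configuration $\omega^{(0)}$ such that from some time on all vertices are active forever; it is monotone if moreover $\omega^{(t+1)}\ge\omega^{(t)}$ coordinatewise for all $t\ge0$. -}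

module Defs where

open import Data.Nat using (ℕ; zero; suc; _+_; _∸_; _≤_; _<_; _≤ᵇ_)
open import Data.Nat.DivMod using (_%_)
open import Data.Fin using (Fin; toℕ; _≟_)
open import Data.Bool using (Bool; true; false; _∧_; _∨_; not)
open import Data.Vec using (Vec; []; _∷_; lookup)
open import Data.List using (List; []; _∷_; map; concatMap; length; filter; allFin)
open import Data.Product using (Σ; _×_; ∃; _,_; proj₁)
open import Relation.Binary.PropositionalEquality using (_≡_)
open import Relation.Nullary.Decidable using (⌊_⌋)
open import Function using (_⇔_)

-- A vertex of the torus T_n^d: a vector of d coordinates in Fin n.
-- Coordinate value i ∈ Fin n represents the element toℕ i + 1 of [n] = {1,…,n}.
Vertex : ℕ → ℕ → Set
Vertex d n = Vec (Fin n) d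

allVertices : (d n : ℕ) → List (Vertex d n)
allVertices zero    n = [] ∷ []
allVertices (suc d) n = concatMap (λ i → map (i ∷_) (allVertices d n)) (allFin n)

eqFin : ∀ {n} → Fin n → Fin n → Bool
eqFin a b = ⌊ a ≟ b ⌋

eqNat : ℕ → ℕ → Bool
eqNat a b = ⌊ a Data.Nat.≟ b ⌋

cyclicNbr : ∀ {n} → Fin n → Fin n → Bool
cyclicNbr {n} a b =
  not (eqFin a b) ∧ (eqNat ((toℕ a + 1) % suc (n ∸ 1)) (toℕ b) ∨ eqNat ((toℕ b + 1) % suc (n ∸ 1)) (toℕ a))

eqVec : ∀ {d n} → Vertex d n → Vertex d n → Bool
eqVec []      []      = true
eqVec (a ∷ x) (b ∷ y) = eqFin a b ∧ eqVec x y

adj : ∀ {d n} → Vertex d n → Vertex d n → Bool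
adj []      []      = false
adj (a ∷ x) (b ∷ y) = (cyclicNbr a b ∧ eqVec x y) ∨ (eqFin a b ∧ adj x y)

Config : ℕ → ℕ → Set
Config d n = Vertex d n → Bool

activeNbrs : ∀ {d n} → Config d n → Vertex d n → ℕ
activeNbrs {d} {n} ω x = length (filter (λ y → (adj x y ∧ ω y) Data.Bool.≟ true) (allVertices d n))

bootstrapStep : ∀ {d n} → ℕ → Config d n → Config d n
bootstrapStep r ω x = ω x ∨ (r ≤ᵇ activeNbrs ω x)

reversibleStep : ∀ {d n} → ℕ → Config d n → Config d n
reversibleStep r ω x = r ≤ᵇ activeNbrs ω x

iterate : ∀ {A : Set} → (A → A) → ℕ → A → A
iterate f zero    a = a
iterate f (suc t) a = f (iterate f t a)

Dynamo : ∀ {d n} → (Config d n → Config d n) → Config d n → Set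
Dynamo step ω = ∃ λ T → ∀ t → T ≤ t → ∀ x → iterate step t ω x ≡ true

Monotone : ∀ {d n} → (Config d n → Config d n) → Config d n → Set
Monotone step ω = ∀ t x → iterate step t ω x ≡ true → iterate step (suc t) ω x ≡ true

MonotoneDynamo : ∀ {d n} → (Config d n → Config d n) → Config d n → Set
MonotoneDynamo step ω = Dynamo step ω × Monotone step ω

K : (d r : ℕ) → Set
K d r = Σ (Fin (d ∸ r + 1) → Fin d) λ k → ∀ i j → toℕ i < toℕ j → toℕ (k i) < toℕ (k j)

-- T(k): vertices x with x_j = 1 (i.e. Fin value 0) for all j ∈ {k_1,…,k_{d-r+1}}
InT : ∀ {d n r} → K d r → Vertex d n → Set
InT (k , _) x = ∀ i → toℕ (lookup x (k i)) ≡ 0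

InD : ∀ {n} (d r : ℕ) → Vertex d n → Set
InD d r x = Σ (K d r) λ k → InT {d} {_} {r} k x

-- A vertex lies in D(r) iff fewer than r of its coordinates differ from 1.  If x ∈ D(r) has
-- exactly r − 1 such coordinates, moving along any of them stays inside D(r), so x has
-- 2(r − 1) ≥ r active neighbours; if it has fewer, all its 2d neighbours lie in D(r).  Hence
-- D(r) ⊆ ω⁽¹⁾, and since the reversible step is monotone in the configuration the whole
-- trajectory is monotone.  A vertex outside D(r) has at least r coordinates different from 1,
-- and lowering any of them gives a neighbour with smaller coordinate sum, so by induction on
-- the coordinate sum every vertex is active from a fixed time on.  Finally a monotone reversible
-- trajectory is also the ordinary bootstrap trajectory, because the bootstrap rule is the
-- disjunction of the current state with the reversible rule.

module Submission where

open import Defs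
open import Data.Nat using (ℕ; _≤_)
open import Data.Bool using (true)
open import Data.Product using (_×_)
open import Relation.Binary.PropositionalEquality using (_≡_)
open import Function using (_⇔_)

open import Data.Nat using (zero; suc; _+_; _*_; _∸_; _<_; _≤ᵇ_; z≤n; s≤s; z<s; s<s⁻¹; _<?_; _≤?_)
open import Data.Nat.Properties
open import Algebra.Properties.CommutativeSemigroup +-commutativeSemigroup using (xy∙z≈y∙xz; xy∙z≈z∙xy)
open import Data.Nat.ListAction using (sum)
open import Data.Nat.ListAction.Properties using (sum-++)
open import Data.Bool using (Bool; false; _∧_; _∨_)
open import Data.Bool.Properties using (T-≡; ∨-zeroʳ)
open import Data.Fin using (Fin; zero; suc; toℕ; fromℕ; fromℕ<; inject₁)
open import Data.Fin.Properties using (toℕ<n; toℕ-fromℕ; toℕ-fromℕ<; toℕ-inject₁; toℕ-injective)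
open import Data.List using (List; []; _∷_; _++_; map; concatMap; filter; length; allFin)
open import Data.List.Properties using (map-++; map-∘; map-cong)
open import Data.List.Membership.Propositional using (_∈_)
open import Data.List.Membership.Propositional.Properties using (∈-allFin; ∈-map⁺; ∈-concatMap⁺)
open import Data.List.Relation.Unary.Any using (here; there)
import Data.List.Relation.Unary.Any as Any
open import Data.Nat.DivMod using (_%_; m%n<n; m<n⇒m%n≡m; n%n≡0)
open import Data.Product using (Σ; _,_)
open import Data.Sum using (_⊎_; inj₁; inj₂)
open import Data.Vec using ([]; _∷_; lookup)
open import Function using (_∘_; Equivalence; mk⇔)
open import Relation.Binary.PropositionalEquality using (refl; sym; trans; cong; cong₂; subst; subst₂; _≢_; module ≡-Reasoning)
open import Relation.Nullary using (¬_; Dec; yes; no; contradiction)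
open import Relation.Nullary.Decidable using (⌊_⌋; isYes≗does; dec-true; dec-false)

⌊⌋-true : ∀ {A : Set} (a? : Dec A) → A → ⌊ a? ⌋ ≡ true
⌊⌋-true a? a = trans (isYes≗does a?) (dec-true a? a)

⌊⌋-false : ∀ {A : Set} (a? : Dec A) → ¬ A → ⌊ a? ⌋ ≡ false
⌊⌋-false a? ¬a = trans (isYes≗does a?) (dec-false a? ¬a)

∧-monoˡ-true : ∀ {p p′} q → (p ≡ true → p′ ≡ true) → p ∧ q ≡ true → p′ ∧ q ≡ true
∧-monoˡ-true {true} q p⇒p′ p∧q rewrite p⇒p′ refl = p∧q

∧-monoʳ-true : ∀ p {q q′} → (q ≡ true → q′ ≡ true) → p ∧ q ≡ true → p ∧ q′ ≡ true
∧-monoʳ-true true q⇒q′ = q⇒q′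

∨-absorbʳ : ∀ {p q} → (p ≡ true → q ≡ true) → p ∨ q ≡ q
∨-absorbʳ {false} _   = refl
∨-absorbʳ {true}  p⇒q = sym (p⇒q refl)

module _ {A : Set} where

  sum-map-mono : {f g : A → ℕ} → (∀ y → f y ≤ g y) → ∀ ys → sum (map f ys) ≤ sum (map g ys)
  sum-map-mono f≤g []       = z≤n
  sum-map-mono f≤g (y ∷ ys) = +-mono-≤ (f≤g y) (sum-map-mono f≤g ys)

  sum-map-concatMap : ∀ {B : Set} (f : A → ℕ) (g : B → List A) is →
    sum (map f (concatMap g is)) ≡ sum (map (λ i → sum (map f (g i))) is)
  sum-map-concatMap f g []       = refl
  sum-map-concatMap f g (i ∷ is) = begin
    sum (map f (g i ++ concatMap g is))
      ≡⟨ cong sum (map-++ f (g i) (concatMap g is)) ⟩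
    sum (map f (g i) ++ map f (concatMap g is))
      ≡⟨ sum-++ (map f (g i)) _ ⟩
    sum (map f (g i)) + sum (map f (concatMap g is))
      ≡⟨ cong (sum (map f (g i)) +_) (sum-map-concatMap f g is) ⟩
    sum (map f (g i)) + sum (map (λ i → sum (map f (g i))) is) ∎
    where open ≡-Reasoning

  ∈⇒≤sum-map : (f : A → ℕ) {y : A} {ys : List A} → y ∈ ys → f y ≤ sum (map f ys)
  ∈⇒≤sum-map f (here refl)                = m≤m+n _ _
  ∈⇒≤sum-map f {ys = z ∷ _} (there y∈ys) = ≤-trans (∈⇒≤sum-map f y∈ys) (m≤n+m _ (f z))

  distinct₂⇒≤sum-map : (f : A → ℕ) {a b : A} {ys : List A} → a ≢ b → a ∈ ys → b ∈ ys →
    f a + f b ≤ sum (map f ys)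
  distinct₂⇒≤sum-map f a≢b (here refl) (here refl) = contradiction refl a≢b
  distinct₂⇒≤sum-map f {a} a≢b (here refl) (there b∈ys) = +-monoʳ-≤ (f a) (∈⇒≤sum-map f b∈ys)
  distinct₂⇒≤sum-map f {a} {b} a≢b (there a∈ys) (here refl) =
    ≤-trans (≤-reflexive (+-comm (f a) (f b))) (+-monoʳ-≤ (f b) (∈⇒≤sum-map f a∈ys))
  distinct₂⇒≤sum-map f {ys = z ∷ _} a≢b (there a∈ys) (there b∈ys) =
    ≤-trans (distinct₂⇒≤sum-map f a≢b a∈ys b∈ys) (m≤n+m _ (f z))

  distinct₃⇒≤sum-map : (f : A → ℕ) {a b c : A} {ys : List A} → a ≢ b → a ≢ c → b ≢ c →
    a ∈ ys → b ∈ ys → c ∈ ys → f a + f b + f c ≤ sum (map f ys)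
  distinct₃⇒≤sum-map f a≢b a≢c b≢c (here refl) (here refl) _ = contradiction refl a≢b
  distinct₃⇒≤sum-map f a≢b a≢c b≢c (here refl) _ (here refl) = contradiction refl a≢c
  distinct₃⇒≤sum-map f a≢b a≢c b≢c _ (here refl) (here refl) = contradiction refl b≢c
  distinct₃⇒≤sum-map f {a} {b} {c} a≢b a≢c b≢c (here refl) (there b∈ys) (there c∈ys) =
    ≤-trans (≤-reflexive (+-assoc (f a) (f b) (f c)))
            (+-monoʳ-≤ (f a) (distinct₂⇒≤sum-map f b≢c b∈ys c∈ys))
  distinct₃⇒≤sum-map f {a} {b} {c} a≢b a≢c b≢c (there a∈ys) (here refl) (there c∈ys) =
    ≤-trans (≤-reflexive (xy∙z≈y∙xz (f a) (f b) (f c)))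
            (+-monoʳ-≤ (f b) (distinct₂⇒≤sum-map f a≢c a∈ys c∈ys))
  distinct₃⇒≤sum-map f {a} {b} {c} a≢b a≢c b≢c (there a∈ys) (there b∈ys) (here refl) =
    ≤-trans (≤-reflexive (xy∙z≈z∙xy (f a) (f b) (f c)))
            (+-monoʳ-≤ (f c) (distinct₂⇒≤sum-map f a≢b a∈ys b∈ys))
  distinct₃⇒≤sum-map f {ys = z ∷ _} a≢b a≢c b≢c (there a∈ys) (there b∈ys) (there c∈ys) =
    ≤-trans (distinct₃⇒≤sum-map f a≢b a≢c b≢c a∈ys b∈ys c∈ys) (m≤n+m _ (f z))

bit : Bool → ℕ
bit false = 0
bit true  = 1

bit-mono : ∀ {p q} → (p ≡ true → q ≡ true) → bit p ≤ bit q
bit-mono {false} _   = z≤n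
bit-mono {true}  p⇒q rewrite p⇒q refl = ≤-refl

count : ∀ {A : Set} → (A → Bool) → List A → ℕ
count c ys = sum (map (bit ∘ c) ys)

length-filter≡count : ∀ {A : Set} (c : A → Bool) ys →
  length (filter (λ y → c y Data.Bool.≟ true) ys) ≡ count c ys
length-filter≡count c [] = refl
length-filter≡count c (y ∷ ys) with c y
... | true  = cong suc (length-filter≡count c ys)
... | false = length-filter≡count c ys

count-mono : ∀ {A : Set} {c c′ : A → Bool} → (∀ y → c y ≡ true → c′ y ≡ true) → ∀ ys → count c ys ≤ count c′ ys
count-mono c⇒c′ = sum-map-mono (λ y → bit-mono (c⇒c′ y))

count-map : ∀ {A B : Set} (c : B → Bool) (f : A → B) xs → count c (map f xs) ≡ count (c ∘ f) xs
count-map c f xs = cong sum (sym (map-∘ xs))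

∈⇒bit≤count : ∀ {A : Set} (c : A → Bool) {y ys} → y ∈ ys → bit (c y) ≤ count c ys
∈⇒bit≤count c = ∈⇒≤sum-map (bit ∘ c)

eqFin-refl : ∀ {n} (a : Fin n) → eqFin a a ≡ true
eqFin-refl a = ⌊⌋-true (a Data.Fin.≟ a) refl

eqVec-refl : ∀ {d n} (x : Vertex d n) → eqVec x x ≡ true
eqVec-refl []      = refl
eqVec-refl (a ∷ x) rewrite eqFin-refl a = eqVec-refl x

adj-∷-same : ∀ {d n} (a : Fin n) {x y : Vertex d n} → adj x y ≡ true → adj (a ∷ x) (a ∷ y) ≡ true
adj-∷-same a x~y rewrite eqFin-refl a | x~y = refl

adj-∷-cyclic : ∀ {d n} {a b : Fin n} (x : Vertex d n) → cyclicNbr a b ≡ true → adj (a ∷ x) (b ∷ x) ≡ true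
adj-∷-cyclic x a~b rewrite a~b | eqVec-refl x = refl

∈-allVertices : ∀ {d n} (x : Vertex d n) → x ∈ allVertices d n
∈-allVertices []                  = here refl
∈-allVertices {suc d} {n} (a ∷ x) =
  ∈-concatMap⁺ (λ i → map (i ∷_) (allVertices d n))
    (Any.map (λ { refl → ∈-map⁺ (a ∷_) (∈-allVertices x) }) (∈-allFin a))

count-allVertices : ∀ {d n} (c : Vertex (suc d) n → Bool) →
  count c (allVertices (suc d) n) ≡ sum (map (λ i → count (c ∘ (i ∷_)) (allVertices d n)) (allFin n))
count-allVertices {d} {n} c =
  trans (sum-map-concatMap (bit ∘ c) (λ i → map (i ∷_) (allVertices d n)) (allFin n))
        (cong sum (map-cong (λ i → count-map c (i ∷_) (allVertices d n)) (allFin n)))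

activeNbrs≡count : ∀ {d n} (ω : Config d n) x → activeNbrs ω x ≡ count (λ y → adj x y ∧ ω y) (allVertices d n)
activeNbrs≡count {d} {n} ω x = length-filter≡count (λ y → adj x y ∧ ω y) (allVertices d n)

-- Reversible and ordinary bootstrap dynamics

_⊆ᶜ_ : ∀ {d n} → Config d n → Config d n → Set
ω₁ ⊆ᶜ ω₂ = ∀ x → ω₁ x ≡ true → ω₂ x ≡ true

activeNbrs-mono : ∀ {d n} {ω₁ ω₂ : Config d n} → ω₁ ⊆ᶜ ω₂ → ∀ x → activeNbrs ω₁ x ≤ activeNbrs ω₂ x
activeNbrs-mono {d} {n} {ω₁} {ω₂} ω₁⊆ω₂ x rewrite activeNbrs≡count ω₁ x | activeNbrs≡count ω₂ x =
  count-mono (λ y → ∧-monoʳ-true (adj x y) (ω₁⊆ω₂ y)) (allVertices d n)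

activeNbrs-cong : ∀ {d n} {ω₁ ω₂ : Config d n} → (∀ y → ω₁ y ≡ ω₂ y) → ∀ x → activeNbrs ω₁ x ≡ activeNbrs ω₂ x
activeNbrs-cong ω₁≗ω₂ x = ≤-antisym (activeNbrs-mono (λ y → trans (sym (ω₁≗ω₂ y))) x)
                                    (activeNbrs-mono (λ y → trans (ω₁≗ω₂ y)) x)

reversibleStep≡true⇔ : ∀ {d n} r (ω : Config d n) x → reversibleStep r ω x ≡ true ⇔ r ≤ activeNbrs ω x
reversibleStep≡true⇔ r ω x = mk⇔ (≤ᵇ⇒≤ r _ ∘ Equivalence.from T-≡) (Equivalence.to T-≡ ∘ ≤⇒≤ᵇ)

reversibleStep-mono : ∀ {d n} r {ω₁ ω₂ : Config d n} → ω₁ ⊆ᶜ ω₂ → reversibleStep r ω₁ ⊆ᶜ reversibleStep r ω₂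
reversibleStep-mono r {ω₁} {ω₂} ω₁⊆ω₂ x e =
  Equivalence.from (reversibleStep≡true⇔ r ω₂ x)
    (≤-trans (Equivalence.to (reversibleStep≡true⇔ r ω₁ x) e) (activeNbrs-mono ω₁⊆ω₂ x))

reversible-monotone : ∀ {d n} r (ω : Config d n) → ω ⊆ᶜ reversibleStep r ω → Monotone (reversibleStep r) ω
reversible-monotone r ω ω⊆Rω zero    = ω⊆Rω
reversible-monotone r ω ω⊆Rω (suc t) = reversibleStep-mono r (reversible-monotone r ω ω⊆Rω t)

monotone⇒persistent : ∀ {d n} {step : Config d n → Config d n} {ω} → Monotone step ω → ∀ t → ω ⊆ᶜ iterate step t ω
monotone⇒persistent mono zero    x ωx = ωx
monotone⇒persistent mono (suc t) x ωx = mono t x (monotone⇒persistent mono t x ωx)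

bootstrap≗reversible : ∀ {d n} r (ω : Config d n) → Monotone (reversibleStep r) ω →
  ∀ t x → iterate (bootstrapStep r) t ω x ≡ iterate (reversibleStep r) t ω x
bootstrap≗reversible r ω mono zero    x = refl
bootstrap≗reversible r ω mono (suc t) x = begin
  B x ∨ (r ≤ᵇ activeNbrs B x)  ≡⟨ cong₂ (λ b k → b ∨ (r ≤ᵇ k)) (IH x) (activeNbrs-cong IH x) ⟩
  R x ∨ reversibleStep r R x   ≡⟨ ∨-absorbʳ (mono t x) ⟩
  reversibleStep r R x         ∎
  where
  open ≡-Reasoning
  B = iterate (bootstrapStep r) t ω
  R = iterate (reversibleStep r) t ω
  IH = bootstrap≗reversible r ω mono t

monotoneDynamo⇒bootstrapDynamo : ∀ {d n} r (ω : Config d n) →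
  MonotoneDynamo (reversibleStep r) ω → Dynamo (bootstrapStep r) ω
monotoneDynamo⇒bootstrapDynamo r ω ((T , active) , mono) =
  T , λ t T≤t x → trans (bootstrap≗reversible r ω mono t x) (active t T≤t x)

-- Coordinates equal to 1 and the set D(r)

ones : ∀ {d n} → Vertex d n → ℕ
ones []          = 0
ones (zero  ∷ x) = suc (ones x)
ones (suc _ ∷ x) = ones x

nonOnes : ∀ {d n} → Vertex d n → ℕ
nonOnes []          = 0
nonOnes (zero  ∷ x) = nonOnes x
nonOnes (suc _ ∷ x) = suc (nonOnes x)

weight : ∀ {d n} → Vertex d n → ℕ
weight []      = 0
weight (a ∷ x) = toℕ a + weight x

ones+nonOnes : ∀ {d n} (x : Vertex d n) → ones x + nonOnes x ≡ d
ones+nonOnes []          = refl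
ones+nonOnes (zero  ∷ x) = cong suc (ones+nonOnes x)
ones+nonOnes (suc _ ∷ x) = trans (+-suc (ones x) (nonOnes x)) (cong suc (ones+nonOnes x))

ones≤ones-∷ : ∀ {d n} (a : Fin n) (x : Vertex d n) → ones x ≤ ones (a ∷ x)
ones≤ones-∷ zero    x = n≤1+n (ones x)
ones≤ones-∷ (suc _) x = ≤-refl

nonOnes≤nonOnes-∷ : ∀ {d n} (a : Fin n) (x : Vertex d n) → nonOnes x ≤ nonOnes (a ∷ x)
nonOnes≤nonOnes-∷ zero    x = ≤-refl
nonOnes≤nonOnes-∷ (suc _) x = n≤1+n (nonOnes x)

nonOnes-∷≤ : ∀ {d n} (a : Fin n) (x : Vertex d n) → nonOnes (a ∷ x) ≤ suc (nonOnes x)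
nonOnes-∷≤ zero    x = n≤1+n (nonOnes x)
nonOnes-∷≤ (suc _) x = ≤-refl

weight≤ : ∀ {d n} (x : Vertex d n) → weight x ≤ d * n
weight≤ []      = z≤n
weight≤ (a ∷ x) = +-mono-≤ (<⇒≤ (toℕ<n a)) (weight≤ x)

Increasing : ∀ {m d} → (Fin m → Fin d) → Set
Increasing k = ∀ i j → toℕ i < toℕ j → toℕ (k i) < toℕ (k j)

-- A tuple k of length m as in K(r), together with x ∈ T(k).
OnesTuple : ∀ {d n} → Vertex d n → ℕ → Set
OnesTuple {d} x m = Σ (Fin m → Fin d) λ k → Increasing k × (∀ i → toℕ (lookup x (k i)) ≡ 0)

Increasing⇒first≤ : ∀ {m d} {k : Fin (suc m) → Fin d} → Increasing k → ∀ i → toℕ (k zero) ≤ toℕ (k i)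
Increasing⇒first≤ inc zero    = ≤-refl
Increasing⇒first≤ inc (suc i) = <⇒≤ (inc zero (suc i) z<s)

emptyTuple : ∀ {d n} (x : Vertex d n) → OnesTuple x 0
emptyTuple x = (λ ()) , (λ ()) , (λ ())

consTuple : ∀ {d n m} {x : Vertex d (suc n)} → OnesTuple x m → OnesTuple (zero ∷ x) (suc m)
consTuple {d} {m = m} {x} (k , inc , onesAt) = k′ , inc′ , onesAt′
  where
  k′ : Fin (suc m) → Fin (suc d)
  k′ zero    = zero
  k′ (suc i) = suc (k i)
  inc′ : Increasing k′
  inc′ zero    zero    ()
  inc′ zero    (suc j) _         = z<s
  inc′ (suc i) zero    ()
  inc′ (suc i) (suc j) (s≤s i<j) = s≤s (inc i j i<j)
  onesAt′ : ∀ i → toℕ (lookup (zero ∷ x) (k′ i)) ≡ 0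
  onesAt′ zero    = refl
  onesAt′ (suc i) = onesAt i

shiftTuple : ∀ {d n m} {a : Fin n} {x : Vertex d n} → OnesTuple x m → OnesTuple (a ∷ x) m
shiftTuple (k , inc , onesAt) = suc ∘ k , (λ i j i<j → s≤s (inc i j i<j)) , onesAt

pred⁺ : ∀ {d} (i : Fin (suc d)) → 0 < toℕ i → Fin d
pred⁺ (suc i) _ = i

suc-pred⁺ : ∀ {d} (i : Fin (suc d)) (0<i : 0 < toℕ i) → suc (pred⁺ i 0<i) ≡ i
suc-pred⁺ (suc i) _ = refl

unshiftTuple : ∀ {d n m} {a : Fin n} {x : Vertex d n} (k : Fin m → Fin (suc d)) → Increasing k →
  (∀ i → toℕ (lookup (a ∷ x) (k i)) ≡ 0) → (∀ i → 0 < toℕ (k i)) → OnesTuple x m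
unshiftTuple {a = a} {x} k inc onesAt 0<k = k′ , inc′ , onesAt′
  where
  k′ = λ i → pred⁺ (k i) (0<k i)
  suc-k′ : ∀ i → suc (k′ i) ≡ k i
  suc-k′ i = suc-pred⁺ (k i) (0<k i)
  inc′ : Increasing k′
  inc′ i j i<j = s<s⁻¹ (subst₂ (λ u v → toℕ u < toℕ v) (sym (suc-k′ i)) (sym (suc-k′ j)) (inc i j i<j))
  onesAt′ : ∀ i → toℕ (lookup x (k′ i)) ≡ 0
  onesAt′ i = subst (λ l → toℕ (lookup (a ∷ x) l) ≡ 0) (sym (suc-k′ i)) (onesAt i)

ones-∷-one : ∀ {d n} {a : Fin n} (x : Vertex d n) → toℕ a ≡ 0 → ones (a ∷ x) ≡ suc (ones x)
ones-∷-one {a = zero} x _ = refl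

onesTuple⇒≤ones : ∀ {d n m} (x : Vertex d n) → OnesTuple x m → m ≤ ones x
onesTuple⇒≤ones {m = zero}  x       _            = z≤n
onesTuple⇒≤ones {m = suc m} []      (k , _)      with k zero
... | ()
onesTuple⇒≤ones {m = suc m} (a ∷ x) (k , inc , onesAt) with k zero in k₀≡
... | zero  = subst (suc m ≤_) (sym (ones-∷-one x a≡1)) (s≤s (onesTuple⇒≤ones x tail))
  where
  a≡1 : toℕ a ≡ 0
  a≡1 = subst (λ l → toℕ (lookup (a ∷ x) l) ≡ 0) k₀≡ (onesAt zero)
  tail : OnesTuple x m
  tail = unshiftTuple (k ∘ suc) (λ i j → inc (suc i) (suc j) ∘ s≤s) (onesAt ∘ suc)
           (λ i → subst (λ l → toℕ l < toℕ (k (suc i))) k₀≡ (inc zero (suc i) z<s))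
... | suc _ = ≤-trans (onesTuple⇒≤ones x all) (ones≤ones-∷ a x)
  where
  all : OnesTuple x (suc m)
  all = unshiftTuple k inc onesAt
          (λ i → ≤-trans (subst (λ l → 0 < toℕ l) (sym k₀≡) z<s) (Increasing⇒first≤ inc i))

≤ones⇒onesTuple : ∀ {d n m} (x : Vertex d n) → m ≤ ones x → OnesTuple x m
≤ones⇒onesTuple {m = zero}  x           _         = emptyTuple x
≤ones⇒onesTuple {m = suc m} (zero  ∷ x) (s≤s m≤)  = consTuple (≤ones⇒onesTuple x m≤)
≤ones⇒onesTuple {m = suc m} (suc _ ∷ x) m≤        = shiftTuple (≤ones⇒onesTuple x m≤)

InD⇔nonOnes< : ∀ {d n r} → r ≤ d → (x : Vertex d n) → InD d r x ⇔ nonOnes x < r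
InD⇔nonOnes< {d} {r = r} r≤d x = mk⇔
  (λ { ((k , inc) , onesAt) → ∸-cancelʳ-< (d∸r<ones (onesTuple⇒≤ones x (k , inc , onesAt))) })
  (λ z<r → let (k , inc , onesAt) = ≤ones⇒onesTuple x (ones>d∸r z<r) in (k , inc) , onesAt)
  where
  d∸nonOnes≡ones : d ∸ nonOnes x ≡ ones x
  d∸nonOnes≡ones = trans (cong (_∸ nonOnes x) (sym (ones+nonOnes x))) (m+n∸n≡m (ones x) (nonOnes x))
  d∸r<ones : d ∸ r + 1 ≤ ones x → d ∸ r < d ∸ nonOnes x
  d∸r<ones p = subst₂ _≤_ (+-comm (d ∸ r) 1) (sym d∸nonOnes≡ones) p
  ones>d∸r : nonOnes x < r → d ∸ r + 1 ≤ ones x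
  ones>d∸r z<r = subst₂ _≤_ (+-comm 1 (d ∸ r)) d∸nonOnes≡ones (∸-monoʳ-< z<r r≤d)

-- The two neighbours along each axis when n ≥ 3

module _ {m : ℕ} where

  private
    N : ℕ
    N = suc (suc (suc m))

  up : Fin N → Fin N
  up a = fromℕ< (m%n<n (toℕ a + 1) N)

  down : Fin N → Fin N
  down zero    = fromℕ (suc (suc m))
  down (suc i) = inject₁ i

  toℕ-up : ∀ a → toℕ (up a) ≡ (toℕ a + 1) % N
  toℕ-up a = toℕ-fromℕ< (m%n<n (toℕ a + 1) N)

  up-view : ∀ a → toℕ (up a) ≡ suc (toℕ a) ⊎ (toℕ (up a) ≡ 0 × suc (toℕ a) ≡ N)
  up-view a with suc (toℕ a) <? N
  ... | yes a+1<N = inj₁ (trans (toℕ-up a) (trans (cong (_% N) (+-comm (toℕ a) 1)) (m<n⇒m%n≡m a+1<N)))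
  ... | no  a+1≮N = inj₂ (trans (toℕ-up a) (trans (cong (_% N) (trans (+-comm (toℕ a) 1) a+1≡N)) (n%n≡0 N)) , a+1≡N)
    where
    a+1≡N : suc (toℕ a) ≡ N
    a+1≡N = ≤-antisym (toℕ<n a) (≮⇒≥ a+1≮N)

  up-down : ∀ a → up (down a) ≡ a
  up-down zero = toℕ-injective (begin
    toℕ (up (down zero))               ≡⟨ toℕ-up (down zero) ⟩
    (toℕ (fromℕ (suc (suc m))) + 1) % N ≡⟨ cong (λ t → (t + 1) % N) (toℕ-fromℕ (suc (suc m))) ⟩
    (suc (suc m) + 1) % N              ≡⟨ cong (_% N) (+-comm (suc (suc m)) 1) ⟩
    N % N                              ≡⟨ n%n≡0 N ⟩
    0                                  ∎)
    where open ≡-Reasoning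
  up-down (suc i) = toℕ-injective (begin
    toℕ (up (inject₁ i))               ≡⟨ toℕ-up (inject₁ i) ⟩
    (toℕ (inject₁ i) + 1) % N          ≡⟨ cong (λ t → (t + 1) % N) (toℕ-inject₁ i) ⟩
    (toℕ i + 1) % N                    ≡⟨ cong (_% N) (+-comm (toℕ i) 1) ⟩
    suc (toℕ i) % N                    ≡⟨ m<n⇒m%n≡m (toℕ<n (suc i)) ⟩
    suc (toℕ i)                        ∎)
    where open ≡-Reasoning

  up≢ : ∀ a → up a ≢ a
  up≢ a up≡a with up-view a
  ... | inj₁ up=a+1         = 1+n≢n (trans (sym up=a+1) (cong toℕ up≡a))
  ... | inj₂ (up=0 , a+1≡N) = 0≢1+n (suc-injective (trans (cong suc (trans (sym up=0) (cong toℕ up≡a))) a+1≡N))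

  down≢ : ∀ a → down a ≢ a
  down≢ a down≡a = up≢ a (trans (cong up (sym down≡a)) (up-down a))

  up≢down : ∀ a → up a ≢ down a
  up≢down zero    up≡down = 0≢1+n (suc-injective (trans (cong toℕ up≡down) (toℕ-fromℕ (suc (suc m)))))
  up≢down (suc i) up≡down with up-view (suc i) | trans (cong toℕ up≡down) (toℕ-inject₁ i)
  ... | inj₁ up=i+2         | up=i = <-irrefl (trans (sym up=i) up=i+2) (m<n⇒m<1+n (n<1+n (toℕ i)))
  ... | inj₂ (up=0 , i+2≡N) | up=i =
    0≢1+n (suc-injective (suc-injective (trans (cong (2 +_) (trans (sym up=0) up=i)) i+2≡N)))

  eqNat-up : ∀ a → eqNat ((toℕ a + 1) % N) (toℕ (up a)) ≡ true
  eqNat-up a = ⌊⌋-true ((toℕ a + 1) % N Data.Nat.≟ toℕ (up a)) (sym (toℕ-up a))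

  cyclicNbr-true : ∀ {a b} → a ≢ b → up a ≡ b ⊎ up b ≡ a → cyclicNbr a b ≡ true
  cyclicNbr-true {a} {b} a≢b a~b rewrite ⌊⌋-false (a Data.Fin.≟ b) a≢b with a~b
  ... | inj₁ refl = cong (_∨ eqNat ((toℕ (up a) + 1) % N) (toℕ a)) (eqNat-up a)
  ... | inj₂ refl = trans (cong (eqNat ((toℕ (up b) + 1) % N) (toℕ b) ∨_) (eqNat-up b)) (∨-zeroʳ _)

  activeNbrs-∷ : ∀ {d} (ω : Config (suc d) N) a x →
    bit (ω (up a ∷ x)) + bit (ω (down a ∷ x)) + activeNbrs (ω ∘ (a ∷_)) x ≤ activeNbrs ω (a ∷ x)
  activeNbrs-∷ {d} ω a x = begin
    bit (ω (up a ∷ x)) + bit (ω (down a ∷ x)) + activeNbrs (ω ∘ (a ∷_)) x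
      ≤⟨ +-mono-≤ (+-mono-≤ (axis (up a) (cyclicNbr-true (up≢ a ∘ sym) (inj₁ refl)))
                            (axis (down a) (cyclicNbr-true (down≢ a ∘ sym) (inj₂ (up-down a)))))
                  slice ⟩
    g (up a) + g (down a) + g a
      ≤⟨ distinct₃⇒≤sum-map g (up≢down a) (up≢ a) (down≢ a) (∈-allFin _) (∈-allFin _) (∈-allFin _) ⟩
    sum (map g (allFin N))
      ≡⟨ count-allVertices (λ y → adj (a ∷ x) y ∧ ω y) ⟨
    count (λ y → adj (a ∷ x) y ∧ ω y) (allVertices (suc d) N)
      ≡⟨ activeNbrs≡count ω (a ∷ x) ⟨
    activeNbrs ω (a ∷ x) ∎
    where
    open ≤-Reasoning
    g : Fin N → ℕ
    g i = count (λ y → adj (a ∷ x) (i ∷ y) ∧ ω (i ∷ y)) (allVertices d N)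
    axis : ∀ b → cyclicNbr a b ≡ true → bit (ω (b ∷ x)) ≤ g b
    axis b a~b = ≤-trans (bit-mono (λ ωbx → subst (λ t → t ∧ ω (b ∷ x) ≡ true) (sym (adj-∷-cyclic {a = a} {b} x a~b)) ωbx))
                         (∈⇒bit≤count (λ y → adj (a ∷ x) (b ∷ y) ∧ ω (b ∷ y)) (∈-allVertices x))
    slice : activeNbrs (ω ∘ (a ∷_)) x ≤ g a
    slice = ≤-trans (≤-reflexive (activeNbrs≡count (ω ∘ (a ∷_)) x))
                    (count-mono (λ y → ∧-monoˡ-true (ω (a ∷ y)) (adj-∷-same a {x} {y})) (allVertices d N))

  axisActive : ∀ {d} → Config d N → Vertex d N → ℕ
  axisActive ω []      = 0
  axisActive ω (a ∷ x) = bit (ω (up a ∷ x)) + bit (ω (down a ∷ x)) + axisActive (ω ∘ (a ∷_)) x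

  axisActive≤activeNbrs : ∀ {d} (ω : Config d N) x → axisActive ω x ≤ activeNbrs ω x
  axisActive≤activeNbrs ω []      = z≤n
  axisActive≤activeNbrs ω (a ∷ x) =
    ≤-trans (+-monoʳ-≤ _ (axisActive≤activeNbrs (ω ∘ (a ∷_)) x)) (activeNbrs-∷ ω a x)

  module _ {d} (ω : Config (suc d) N) {a : Fin N} {x : Vertex d N} {k : ℕ} where

    axisActive-∷-skip : k ≤ axisActive (ω ∘ (a ∷_)) x → k ≤ axisActive ω (a ∷ x)
    axisActive-∷-skip k≤ = ≤-trans k≤ (m≤n+m _ _)

    axisActive-∷-down : ω (down a ∷ x) ≡ true → k ≤ axisActive (ω ∘ (a ∷_)) x → suc k ≤ axisActive ω (a ∷ x)
    axisActive-∷-down down∈ω k≤ rewrite down∈ω =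
      ≤-trans (s≤s k≤) (+-monoˡ-≤ (axisActive (ω ∘ (a ∷_)) x) (m≤n+m 1 (bit (ω (up a ∷ x)))))

    axisActive-∷-both : ω (up a ∷ x) ≡ true → ω (down a ∷ x) ≡ true →
      k ≤ axisActive (ω ∘ (a ∷_)) x → 2 + k ≤ axisActive ω (a ∷ x)
    axisActive-∷-both up∈ω down∈ω k≤ rewrite up∈ω | down∈ω = s≤s (s≤s k≤)

  2*nonOnes≤axisActive : ∀ {d} (ω : Config d N) x →
    (∀ y → nonOnes y ≤ nonOnes x → ω y ≡ true) → 2 * nonOnes x ≤ axisActive ω x
  2*nonOnes≤axisActive ω []          _    = z≤n
  2*nonOnes≤axisActive ω (zero  ∷ x) D⊆ω =
    axisActive-∷-skip ω (2*nonOnes≤axisActive (ω ∘ (zero ∷_)) x (D⊆ω ∘ (zero ∷_)))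
  2*nonOnes≤axisActive ω (suc i ∷ x) D⊆ω = begin
    2 * suc (nonOnes x)   ≡⟨ *-suc 2 (nonOnes x) ⟩
    2 + 2 * nonOnes x     ≤⟨ axisActive-∷-both ω (D⊆ω _ (nonOnes-∷≤ (up (suc i)) x))
                                                 (D⊆ω _ (nonOnes-∷≤ (down (suc i)) x))
                             (2*nonOnes≤axisActive (ω ∘ (suc i ∷_)) x (λ y → D⊆ω (suc i ∷ y) ∘ s≤s)) ⟩
    axisActive ω (suc i ∷ x) ∎
    where open ≤-Reasoning

  2*d≤axisActive : ∀ {d} (ω : Config d N) x →
    (∀ y → nonOnes y ≤ suc (nonOnes x) → ω y ≡ true) → 2 * d ≤ axisActive ω x
  2*d≤axisActive ω []      _    = z≤n
  2*d≤axisActive {suc d} ω (a ∷ x) D⊆ω = begin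
    2 * suc d     ≡⟨ *-suc 2 d ⟩
    2 + 2 * d     ≤⟨ axisActive-∷-both ω (D⊆ω _ (neighbour (up a))) (D⊆ω _ (neighbour (down a)))
                       (2*d≤axisActive (ω ∘ (a ∷_)) x (λ y → D⊆ω (a ∷ y) ∘ slice a)) ⟩
    axisActive ω (a ∷ x) ∎
    where
    open ≤-Reasoning
    neighbour : ∀ b → nonOnes (b ∷ x) ≤ suc (nonOnes (a ∷ x))
    neighbour b = ≤-trans (nonOnes-∷≤ b x) (s≤s (nonOnes≤nonOnes-∷ a x))
    slice : ∀ c {y} → nonOnes y ≤ suc (nonOnes x) → nonOnes (c ∷ y) ≤ suc (nonOnes (c ∷ x))
    slice zero    y≤ = y≤
    slice (suc _) y≤ = s≤s y≤

  nonOnes≤axisActive : ∀ {d} (ω : Config d N) x →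
    (∀ y → weight y < weight x → ω y ≡ true) → nonOnes x ≤ axisActive ω x
  nonOnes≤axisActive ω []          _          = z≤n
  nonOnes≤axisActive ω (zero  ∷ x) lighter⊆ω =
    axisActive-∷-skip ω (nonOnes≤axisActive (ω ∘ (zero ∷_)) x (lighter⊆ω ∘ (zero ∷_)))
  nonOnes≤axisActive ω (suc i ∷ x) lighter⊆ω =
    axisActive-∷-down ω (lighter⊆ω _ down-lighter)
      (nonOnes≤axisActive (ω ∘ (suc i ∷_)) x (λ y → lighter⊆ω (suc i ∷ y) ∘ +-monoʳ-< (suc (toℕ i))))
    where
    down-lighter : weight (down (suc i) ∷ x) < weight (suc i ∷ x)
    down-lighter = s≤s (≤-reflexive (cong (_+ weight x) (toℕ-inject₁ i)))

≤1+n⇒≤2*n : ∀ {r z} → 2 ≤ r → r ≤ suc z → r ≤ 2 * z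
≤1+n⇒≤2*n {z = zero}  (s≤s (s≤s _)) (s≤s ())
≤1+n⇒≤2*n {z = suc z} _ r≤2+z =
  ≤-trans r≤2+z (≤-trans (+-monoʳ-≤ 2 (m≤n*m z 2)) (≤-reflexive (sym (*-suc 2 z))))

module _ {d r m : ℕ} (2≤r : 2 ≤ r) (r≤d : r ≤ d) (ω : Config d (suc (suc (suc m))))
         (ω⇔D : ∀ x → (ω x ≡ true) ⇔ InD d r x) where

  private
    D⊆ω : ∀ y → nonOnes y < r → ω y ≡ true
    D⊆ω y y∈D = Equivalence.from (ω⇔D y) (Equivalence.from (InD⇔nonOnes< r≤d y) y∈D)

  ω⊆reversibleStep : ω ⊆ᶜ reversibleStep r ω
  ω⊆reversibleStep x ωx =
    Equivalence.from (reversibleStep≡true⇔ r ω x) (≤-trans r≤axisActive (axisActive≤activeNbrs ω x))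
    where
    x∈D : nonOnes x < r
    x∈D = Equivalence.to (InD⇔nonOnes< r≤d x) (Equivalence.to (ω⇔D x) ωx)
    r≤axisActive : r ≤ axisActive ω x
    r≤axisActive with 2 + nonOnes x ≤? r
    ... | yes 2+z≤r = ≤-trans r≤d (≤-trans (m≤n*m d 2)
                        (2*d≤axisActive ω x (λ y y≤ → D⊆ω y (≤-trans (s≤s y≤) 2+z≤r))))
    ... | no  2+z≰r = ≤-trans (≤1+n⇒≤2*n 2≤r (≤-pred (≰⇒> 2+z≰r)))
                        (2*nonOnes≤axisActive ω x (λ y y≤ → D⊆ω y (≤-trans (s≤s y≤) x∈D)))

  reversibleMonotone : Monotone (reversibleStep r) ω
  reversibleMonotone = reversible-monotone r ω ω⊆reversibleStep

  activated : ∀ t x → weight x < t → iterate (reversibleStep r) t ω x ≡ true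
  activated (suc t) x x<t with nonOnes x <? r
  ... | yes x∈D = monotone⇒persistent reversibleMonotone (suc t) x (D⊆ω x x∈D)
  ... | no  x∉D = Equivalence.from (reversibleStep≡true⇔ r (iterate (reversibleStep r) t ω) x) (begin
    r                                             ≤⟨ ≮⇒≥ x∉D ⟩
    nonOnes x                                     ≤⟨ nonOnes≤axisActive _ x lighter-active ⟩
    axisActive (iterate (reversibleStep r) t ω) x ≤⟨ axisActive≤activeNbrs _ x ⟩
    activeNbrs (iterate (reversibleStep r) t ω) x ∎)
    where
    open ≤-Reasoning
    lighter-active : ∀ y → weight y < weight x → iterate (reversibleStep r) t ω y ≡ true
    lighter-active y y<x = activated t y (<-≤-trans y<x (≤-pred x<t))

  reversibleDynamo : Dynamo (reversibleStep r) ω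
  reversibleDynamo = suc (d * suc (suc (suc m))) , λ t T≤t x → activated t x (≤-trans (s≤s (weight≤ x)) T≤t)

lemma2 : (d n r : ℕ) → 2 ≤ r → r ≤ d → 3 ≤ n →
    (ω : Config d n) → (∀ x → (ω x ≡ true) ⇔ InD d r x) →
    MonotoneDynamo (reversibleStep r) ω × Dynamo (bootstrapStep r) ω
lemma2 d n r 2≤r r≤d (s≤s (s≤s (s≤s z≤n))) ω ω⇔D =
  monotoneDynamo , monotoneDynamo⇒bootstrapDynamo r ω monotoneDynamo
  where
  monotoneDynamo : MonotoneDynamo (reversibleStep r) ω
  monotoneDynamo = reversibleDynamo 2≤r r≤d ω ω⇔D , reversibleMonotone 2≤r r≤d ω ω⇔D
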